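{- For every odd positive integer $n$ that is not a perfect square, $\overline{p}(n)\equiv 0\pmod 8$.
   Context: An overpartition of $n$ is a partition of $n$ in which the first occurrence of each part may be overlined; $\overline{p}(n)$ is the number of overpartitions of $n$ ($\overline{p}(0)=1$), with generating function $\prod_{n\geq1}\frac{1+q^n}{1-q^n}$. -}

module Defs where

open import Data.Nat using (ℕ; zero; suc; _+_; _*_; _∸_; _≤ᵇ_)
open import Data.Bool using (if_then_else_)

-- Formal power series over ℕ, represented by coefficient functions.
Series : Set
Series = ℕ → ℕ

one : Series
one zero    = 1
one (suc _) = 0

sumTo : ℕ → (ℕ → ℕ) → ℕ
sumTo zero    f = f 0
sumTo (suc m) f = sumTo m f + f (suc m)

-- multiplication by (1 + q^k):  coefficient i is a i + a (i - k) when k ≤ i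
mulOnePlus : ℕ → Series → Series
mulOnePlus k a i = a i + (if k ≤ᵇ i then a (i ∸ k) else 0)

-- multiplication by 1/(1 - q^k) = sum_{j ≥ 0} q^{jk}:
-- coefficient i is sum over j with j*k ≤ i of a (i - j*k)
mulGeom : ℕ → Series → Series
mulGeom k a i = sumTo i (λ j → if j * k ≤ᵇ i then a (i ∸ j * k) else 0)

overGF : ℕ → Series
overGF zero    = one
overGF (suc m) = mulGeom (suc m) (mulOnePlus (suc m) (overGF m))

-- number of overpartitions of n: the coefficient of q^n in
-- ∏_{k ≥ 1} (1 + q^k)/(1 - q^k); factors with k > n do not affect it.
overpartition : ℕ → ℕ
overpartition n = overGF n n

{-# OPTIONS --safe #-}
-- Since (1 + q^k)/(1 − q^k) = 1 + 2 q^k/(1 − q^k), expanding the product gives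
-- p̄(n) ≡ 2 e₁(n) + 4 e₂(n) (mod 8), where e₁(n) counts the factorisations n = (j + 1) k and
-- e₂(n) the representations n = (J + 1) K + (J′ + 1) L with 0 < L < K.  For non-square n,
-- exchanging divisor and codivisor pairs off the factorisations, so e₁(n) = 2 s with s the
-- number of divisors k < n / k.  The involution (K, J, L, J′) ↦ (J + J′ + 2, L − 1, J + 1, K − L − 1)
-- pairs off the representations except for its fixed points, which for odd n correspond
-- exactly to those s small divisors.  Hence s + e₂(n) is even and p̄(n) ≡ 4 (s + e₂(n)) ≡ 0 (mod 8).
module Submission where

open import Defs
open import Data.Bool using (T; true; false; if_then_else_)
open import Data.Empty using (⊥-elim)
open import Data.List using (List; []; _∷_; _++_; length; map; filter)
open import Data.List.Properties using (length-++; length-map; length-filter; filter-accept; filter-reject; filter-all)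
open import Data.List.Membership.Propositional using (_∈_)
open import Data.List.Membership.Propositional.Properties
  using (∈-map⁺; ∈-map⁻; ∈-++⁺ˡ; ∈-++⁺ʳ; ∈-++⁻; ∈-filter⁺; ∈-filter⁻)
import Data.List.Relation.Unary.All as All
open import Data.List.Relation.Unary.Any using (here; there)
open import Data.List.Relation.Unary.Unique.Propositional using (Unique; []; _∷_)
import Data.List.Relation.Unary.Unique.Propositional.Properties as Unique
open import Data.List.Relation.Binary.Permutation.Propositional
  using (_↭_; ↭-refl; ↭-reflexive; ↭-prep; ↭-swap; ↭-trans)
open import Data.List.Relation.Binary.Permutation.Propositional.Properties using (↭-length; filter-↭)
open import Data.Nat using (ℕ; zero; suc; pred; _+_; _*_; _∸_; _/_; _%_; _≤ᵇ_; _≤_; _<_; _<?_; z≤n; s≤s)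
open import Data.Nat.DivMod using (m≡m%n+[m/n]*n; %-distribˡ-*; m%n<n; m*n/n≡m)
open import Data.Nat.Divisibility using (_∣_; divides)
open import Data.Nat.Induction using (<-wellFounded)
open import Data.Nat.Properties
open import Algebra.Properties.CommutativeSemigroup +-commutativeSemigroup using (interchange)
open import Data.Nat.Tactic.RingSolver using (solve-∀)
open import Data.Product using (∃; _×_; _,_; proj₁; proj₂)
import Data.Product.Properties as Product
open import Data.Sum using (_⊎_; inj₁; inj₂)
import Data.Sum.Properties as Sum
open import Data.Unit using (⊤; tt)
import Data.Unit.Properties as Unit
open import Function using (_∘_; _on_; case_of_)
open import Induction.WellFounded using (Acc; acc)
open import Level using (0ℓ)
open import Relation.Binary.Construct.On using (wellFounded)
open import Relation.Binary.Definitions using (DecidableEquality; tri<; tri≈; tri>)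
open import Relation.Binary.PropositionalEquality
open import Relation.Nullary using (¬_; Dec; yes; no; ¬?)
open import Relation.Unary using (Pred; Decidable)
open ≡-Reasoning

private
  variable
    E : Set

-- Coefficient algebra

shift : ℕ → Series → Series
shift s a i = if s ≤ᵇ i then a (i ∸ s) else 0

shift-suc : ∀ s (a : Series) i → shift (suc s) a (suc i) ≡ shift s a i
shift-suc zero    a i = refl
shift-suc (suc s) a i = refl

shift-beyond : ∀ {s i} (a : Series) → i < s → shift s a i ≡ 0
shift-beyond {suc s} {zero}  a i<s       = refl
shift-beyond {suc s} {suc i} a (s≤s i<s) = trans (shift-suc s a i) (shift-beyond a i<s)

shift-shift : ∀ s k (a : Series) i → shift s (shift k a) i ≡ shift (s + k) a i
shift-shift zero    k a i       = refl
shift-shift (suc s) k a zero    = refl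
shift-shift (suc s) k a (suc i) = begin
  shift (suc s) (shift k a) (suc i) ≡⟨ shift-suc s (shift k a) i ⟩
  shift s (shift k a) i             ≡⟨ shift-shift s k a i ⟩
  shift (s + k) a i                 ≡⟨ shift-suc (s + k) a i ⟨
  shift (suc s + k) a (suc i)       ∎

shift-cong : ∀ s {a b : Series} → (∀ x → a x ≡ b x) → ∀ i → shift s a i ≡ shift s b i
shift-cong s a≗b i with s ≤ᵇ i
... | true  = a≗b (i ∸ s)
... | false = refl

shift-+ : ∀ s (a b : Series) i → shift s (λ x → a x + b x) i ≡ shift s a i + shift s b i
shift-+ s a b i with s ≤ᵇ i
... | true  = refl
... | false = refl

shift-* : ∀ s c (a : Series) i → shift s (λ x → c * a x) i ≡ c * shift s a i
shift-* s c a i with s ≤ᵇ i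
... | true  = refl
... | false = sym (*-zeroʳ c)

sumTo-cong : ∀ m {f g : ℕ → ℕ} → (∀ j → f j ≡ g j) → sumTo m f ≡ sumTo m g
sumTo-cong zero    f≗g = f≗g 0
sumTo-cong (suc m) f≗g = cong₂ _+_ (sumTo-cong m f≗g) (f≗g (suc m))

sumTo-+ : ∀ m (f g : ℕ → ℕ) → sumTo m (λ j → f j + g j) ≡ sumTo m f + sumTo m g
sumTo-+ zero    f g = refl
sumTo-+ (suc m) f g = begin
  sumTo m (λ j → f j + g j) + (f (suc m) + g (suc m)) ≡⟨ cong (_+ (f (suc m) + g (suc m))) (sumTo-+ m f g) ⟩
  sumTo m f + sumTo m g + (f (suc m) + g (suc m))     ≡⟨ interchange (sumTo m f) _ _ _ ⟩
  sumTo m f + f (suc m) + (sumTo m g + g (suc m))     ∎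

sumTo-* : ∀ m c (f : ℕ → ℕ) → sumTo m (λ j → c * f j) ≡ c * sumTo m f
sumTo-* zero    c f = refl
sumTo-* (suc m) c f = trans (cong (_+ c * f (suc m)) (sumTo-* m c f)) (sym (*-distribˡ-+ c _ _))

sumTo-head : ∀ m (f : ℕ → ℕ) → sumTo (suc m) f ≡ f 0 + sumTo m (λ j → f (suc j))
sumTo-head zero    f = refl
sumTo-head (suc m) f = begin
  sumTo (suc m) f + f (suc (suc m))                   ≡⟨ cong (_+ f (suc (suc m))) (sumTo-head m f) ⟩
  f 0 + sumTo m (λ j → f (suc j)) + f (suc (suc m))   ≡⟨ +-assoc (f 0) _ _ ⟩
  f 0 + sumTo (suc m) (λ j → f (suc j))               ∎

-- Multiplication by q^k/(1 − q^k) = q^k + q^2k + ⋯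
mulLambert : ℕ → Series → Series
mulLambert k a i = sumTo i (λ j → shift (suc j * k) a i)

mulLambert-cong : ∀ k {a b : Series} → (∀ x → a x ≡ b x) → ∀ i → mulLambert k a i ≡ mulLambert k b i
mulLambert-cong k a≗b i = sumTo-cong i (λ j → shift-cong (suc j * k) a≗b i)

mulLambert-linear : ∀ k (a b : Series) c i →
                    mulLambert k (λ x → a x + c * b x) i ≡ mulLambert k a i + c * mulLambert k b i
mulLambert-linear k a b c i = begin
  mulLambert k (λ x → a x + c * b x) i
    ≡⟨ sumTo-cong i (λ j → shift-+ (suc j * k) a (λ x → c * b x) i) ⟩
  sumTo i (λ j → shift (suc j * k) a i + shift (suc j * k) (λ x → c * b x) i)
    ≡⟨ sumTo-+ i _ _ ⟩
  mulLambert k a i + sumTo i (λ j → shift (suc j * k) (λ x → c * b x) i)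
    ≡⟨ cong (mulLambert k a i +_) (sumTo-cong i (λ j → shift-* (suc j * k) c b i)) ⟩
  mulLambert k a i + sumTo i (λ j → c * shift (suc j * k) b i)
    ≡⟨ cong (mulLambert k a i +_) (sumTo-* i c _) ⟩
  mulLambert k a i + c * mulLambert k b i ∎

sumTo-shift-multiples : ∀ k (a : Series) i →
                        sumTo i (λ j → shift (j * suc k) a i) ≡ a i + mulLambert (suc k) a i
sumTo-shift-multiples k a i = +-cancelʳ-≡ _ _ _ (begin
  sumTo i f + f (suc i)          ≡⟨ sumTo-head i f ⟩
  a i + mulLambert (suc k) a i   ≡⟨ +-identityʳ _ ⟨
  a i + mulLambert (suc k) a i + 0 ≡⟨ cong (a i + mulLambert (suc k) a i +_) (shift-beyond a i<) ⟨
  a i + mulLambert (suc k) a i + f (suc i) ∎)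
  where
  f = λ j → shift (j * suc k) a i
  i< : i < suc i * suc k
  i< = s≤s (≤-trans (m≤m*n i (suc k)) (m≤n+m (i * suc k) k))

mulGeom-mulOnePlus : ∀ k (a : Series) i →
                     mulGeom (suc k) (mulOnePlus (suc k) a) i ≡ a i + 2 * mulLambert (suc k) a i
mulGeom-mulOnePlus k a i = begin
  mulGeom (suc k) (mulOnePlus (suc k) a) i
    ≡⟨ sumTo-cong i (λ j → shift-+ (j * suc k) a (shift (suc k) a) i) ⟩
  sumTo i (λ j → shift (j * suc k) a i + shift (j * suc k) (shift (suc k) a) i)
    ≡⟨ sumTo-+ i _ _ ⟩
  sumTo i (λ j → shift (j * suc k) a i) + sumTo i (λ j → shift (j * suc k) (shift (suc k) a) i)
    ≡⟨ cong₂ _+_ (sumTo-shift-multiples k a i) (sumTo-cong i shift-multiple) ⟩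
  a i + mulLambert (suc k) a i + mulLambert (suc k) a i
    ≡⟨ +-assoc (a i) _ _ ⟩
  a i + (mulLambert (suc k) a i + mulLambert (suc k) a i)
    ≡⟨ cong (a i +_) (cong (mulLambert (suc k) a i +_) (+-identityʳ _)) ⟨
  a i + 2 * mulLambert (suc k) a i ∎
  where
  shift-multiple : ∀ j → shift (j * suc k) (shift (suc k) a) i ≡ shift (suc j * suc k) a i
  shift-multiple j = trans (shift-shift (j * suc k) (suc k) a i)
                           (cong (λ s → shift s a i) (+-comm (j * suc k) (suc k)))

lambertSum : (ℕ → Series) → ℕ → Series
lambertSum F zero    i = 0
lambertSum F (suc m) i = lambertSum F m i + mulLambert (suc m) (F m) i

-- The first two elementary symmetric functions of the series q^k/(1 − q^k), 1 ≤ k ≤ m.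
e₁ e₂ : ℕ → Series
e₁ = lambertSum (λ _ → one)
e₂ = lambertSum e₁

higher : ℕ → Series
higher zero    i = 0
higher (suc m) i = higher m i + mulLambert (suc m) (e₂ m) i + 2 * mulLambert (suc m) (higher m) i

overGF-expansion : ∀ m i → overGF m i ≡ one i + 2 * (e₁ m i + 2 * (e₂ m i + 2 * higher m i))
overGF-expansion zero    i = sym (+-identityʳ (one i))
overGF-expansion (suc m) i = begin
  overGF (suc m) i                  ≡⟨ mulGeom-mulOnePlus m (overGF m) i ⟩
  overGF m i + 2 * L (overGF m)     ≡⟨ cong₂ (λ u v → u + 2 * v) (overGF-expansion m i)
                                             (mulLambert-cong (suc m) (overGF-expansion m) i) ⟩
  S i + 2 * L S                     ≡⟨ cong (λ v → S i + 2 * v) expand ⟩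
  S i + 2 * (L one + 2 * (L (e₁ m) + 2 * (L (e₂ m) + 2 * L (higher m))))
    ≡⟨ regroup (one i) (e₁ m i) (e₂ m i) (higher m i) (L one) (L (e₁ m)) (L (e₂ m)) (L (higher m)) ⟩
  one i + 2 * (e₁ (suc m) i + 2 * (e₂ (suc m) i + 2 * higher (suc m) i)) ∎
  where
  S : Series
  S x = one x + 2 * (e₁ m x + 2 * (e₂ m x + 2 * higher m x))
  L : Series → ℕ
  L a = mulLambert (suc m) a i
  expand : L S ≡ L one + 2 * (L (e₁ m) + 2 * (L (e₂ m) + 2 * L (higher m)))
  expand = begin
    L S
      ≡⟨ mulLambert-linear (suc m) one (λ x → e₁ m x + 2 * (e₂ m x + 2 * higher m x)) 2 i ⟩
    L one + 2 * L (λ x → e₁ m x + 2 * (e₂ m x + 2 * higher m x))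
      ≡⟨ cong (λ v → L one + 2 * v) (mulLambert-linear (suc m) (e₁ m) (λ x → e₂ m x + 2 * higher m x) 2 i) ⟩
    L one + 2 * (L (e₁ m) + 2 * L (λ x → e₂ m x + 2 * higher m x))
      ≡⟨ cong (λ v → L one + 2 * (L (e₁ m) + 2 * v)) (mulLambert-linear (suc m) (e₂ m) (higher m) 2 i) ⟩
    L one + 2 * (L (e₁ m) + 2 * (L (e₂ m) + 2 * L (higher m))) ∎
  regroup : ∀ o a b c la lb lc ld →
            o + 2 * (a + 2 * (b + 2 * c)) + 2 * (la + 2 * (lb + 2 * (lc + 2 * ld)))
            ≡ o + 2 * ((a + la) + 2 * ((b + lb) + 2 * (c + lc + 2 * ld)))
  regroup = solve-∀

-- Lists modelling the coefficients

shiftList : ℕ → (ℕ → List E) → ℕ → List E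
shiftList s M i = if s ≤ᵇ i then M (i ∸ s) else []

length-shiftList : ∀ s (M : ℕ → List E) i → length (shiftList s M i) ≡ shift s (λ x → length (M x)) i
length-shiftList s M i with s ≤ᵇ i
... | true  = refl
... | false = refl

∈-shiftList⁻ : ∀ s (M : ℕ → List E) i {e} → e ∈ shiftList s M i → s ≤ i × e ∈ M (i ∸ s)
∈-shiftList⁻ s M i e∈ with s ≤ᵇ i in s≤ᵇi
... | true = ≤ᵇ⇒≤ s i (subst T (sym s≤ᵇi) tt) , e∈

∈-shiftList⁺ : ∀ {s i} (M : ℕ → List E) {e} → s ≤ i → e ∈ M (i ∸ s) → e ∈ shiftList s M i
∈-shiftList⁺ {s = s} {i} M s≤i e∈ with s ≤ᵇ i | ≤⇒≤ᵇ s≤i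
... | true | _ = e∈

shiftList-unique : ∀ s {M : ℕ → List E} i → (∀ x → Unique (M x)) → Unique (shiftList s M i)
shiftList-unique s i unique with s ≤ᵇ i
... | true  = unique (i ∸ s)
... | false = []

concatTo : ℕ → (ℕ → List E) → List E
concatTo zero    F = F 0
concatTo (suc m) F = concatTo m F ++ F (suc m)

length-concatTo : ∀ m (F : ℕ → List E) → length (concatTo m F) ≡ sumTo m (λ j → length (F j))
length-concatTo zero    F = refl
length-concatTo (suc m) F = trans (length-++ (concatTo m F)) (cong (_+ length (F (suc m))) (length-concatTo m F))

∈-concatTo⁻ : ∀ m (F : ℕ → List E) {x} → x ∈ concatTo m F → ∃ λ j → j ≤ m × x ∈ F j
∈-concatTo⁻ zero    F x∈ = 0 , z≤n , x∈
∈-concatTo⁻ (suc m) F x∈ with ∈-++⁻ (concatTo m F) x∈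
... | inj₁ x∈ˡ = let j , j≤m , x∈Fj = ∈-concatTo⁻ m F x∈ˡ in j , m≤n⇒m≤1+n j≤m , x∈Fj
... | inj₂ x∈ʳ = suc m , ≤-refl , x∈ʳ

∈-concatTo⁺ : ∀ {m j} (F : ℕ → List E) {x} → j ≤ m → x ∈ F j → x ∈ concatTo m F
∈-concatTo⁺ {m = zero}  F z≤n x∈ = x∈
∈-concatTo⁺ {m = suc m} F j≤1+m x∈ with m≤n⇒m<n∨m≡n j≤1+m
... | inj₁ (s≤s j≤m) = ∈-++⁺ˡ (∈-concatTo⁺ F j≤m x∈)
... | inj₂ refl      = ∈-++⁺ʳ (concatTo m F) x∈

concatTo-unique : ∀ m (F : ℕ → List E) → (∀ j → Unique (F j)) →
                  (∀ {j j′ x} → x ∈ F j → x ∈ F j′ → j ≡ j′) → Unique (concatTo m F)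
concatTo-unique zero    F unique disjoint = unique 0
concatTo-unique (suc m) F unique disjoint =
  Unique.++⁺ (concatTo-unique m F unique disjoint) (unique (suc m)) λ (x∈ˡ , x∈ʳ) →
    let j , j≤m , x∈Fj = ∈-concatTo⁻ m F x∈ˡ in <-irrefl (disjoint x∈Fj x∈ʳ) (s≤s j≤m)

-- An element (k , j , e) of mulLambertList k M i stands for the product of the term q^{(j+1)k}
-- of q^k/(1 − q^k) with the term of the series counted by M that e stands for.
mulLambertList : ℕ → (ℕ → List E) → ℕ → List (ℕ × ℕ × E)
mulLambertList k M i = concatTo i (λ j → map (λ e → k , j , e) (shiftList (suc j * k) M i))

length-mulLambertList : ∀ k (M : ℕ → List E) i →
                        length (mulLambertList k M i) ≡ mulLambert k (λ x → length (M x)) i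
length-mulLambertList k M i = trans (length-concatTo i _) (sumTo-cong i λ j →
  trans (length-map _ (shiftList (suc j * k) M i)) (length-shiftList (suc j * k) M i))

∈-mulLambertList⁻ : ∀ k (M : ℕ → List E) i {k′ j e} → (k′ , j , e) ∈ mulLambertList k M i →
                    k′ ≡ k × suc j * k ≤ i × e ∈ M (i ∸ suc j * k)
∈-mulLambertList⁻ k M i x∈ with ∈-concatTo⁻ i _ x∈
... | j , _ , x∈Fj with ∈-map⁻ (λ e → k , j , e) x∈Fj
...   | e , e∈ , refl = refl , ∈-shiftList⁻ (suc j * k) M i e∈

∈-mulLambertList⁺ : ∀ {k i j} (M : ℕ → List E) {e} → 0 < k → suc j * k ≤ i → e ∈ M (i ∸ suc j * k) →
                    (k , j , e) ∈ mulLambertList k M i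
∈-mulLambertList⁺ {k = suc k} {i} {j} M _ le e∈ =
  ∈-concatTo⁺ (λ j → map (λ e → suc k , j , e) (shiftList (suc j * suc k) M i))
              (≤-trans (n≤1+n j) (≤-trans (m≤m*n (suc j) (suc k)) le))
              (∈-map⁺ (λ e → suc k , j , e) (∈-shiftList⁺ M le e∈))

mulLambertList-unique : ∀ k {M : ℕ → List E} i → (∀ x → Unique (M x)) → Unique (mulLambertList k M i)
mulLambertList-unique k {M} i unique = concatTo-unique i _
  (λ j → Unique.map⁺ (λ { refl → refl }) (shiftList-unique (suc j * k) i unique)) same-tag
  where
  same-tag : ∀ {j j′ x} → x ∈ map (λ e → k , j , e) (shiftList (suc j * k) M i) →
             x ∈ map (λ e → k , j′ , e) (shiftList (suc j′ * k) M i) → j ≡ j′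
  same-tag {j} {j′} x∈ x∈′ with ∈-map⁻ (λ e → k , j , e) x∈ | ∈-map⁻ (λ e → k , j′ , e) x∈′
  ... | _ , _ , refl | _ , _ , refl = refl

lambertSumList : (ℕ → ℕ → List E) → ℕ → ℕ → List (ℕ × ℕ × E)
lambertSumList M zero    i = []
lambertSumList M (suc m) i = lambertSumList M m i ++ mulLambertList (suc m) (M m) i

module _ {M : ℕ → ℕ → List E} where

  length-lambertSumList : ∀ {F} → (∀ m x → length (M m x) ≡ F m x) →
                          ∀ m i → length (lambertSumList M m i) ≡ lambertSum F m i
  length-lambertSumList lengths zero    i = refl
  length-lambertSumList lengths (suc m) i = trans (length-++ (lambertSumList M m i)) (cong₂ _+_
    (length-lambertSumList lengths m i)
    (trans (length-mulLambertList (suc m) (M m) i) (mulLambert-cong (suc m) (lengths m) i)))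

  ∈-lambertSumList⁻ : ∀ m i {k j e} → (k , j , e) ∈ lambertSumList M m i →
                      0 < k × k ≤ m × suc j * k ≤ i × e ∈ M (pred k) (i ∸ suc j * k)
  ∈-lambertSumList⁻ (suc m) i x∈ with ∈-++⁻ (lambertSumList M m i) x∈
  ... | inj₁ x∈ˡ = let 0<k , k≤m , rest = ∈-lambertSumList⁻ m i x∈ˡ in 0<k , m≤n⇒m≤1+n k≤m , rest
  ... | inj₂ x∈ʳ with ∈-mulLambertList⁻ (suc m) (M m) i x∈ʳ
  ...   | refl , rest = s≤s z≤n , ≤-refl , rest

  ∈-lambertSumList⁺ : ∀ {m i k j e} → 0 < k → k ≤ m → suc j * k ≤ i → e ∈ M (pred k) (i ∸ suc j * k) →
                      (k , j , e) ∈ lambertSumList M m i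
  ∈-lambertSumList⁺ {m = zero}  (s≤s z≤n) () _ _
  ∈-lambertSumList⁺ {m = suc m} 0<k k≤1+m le e∈ with m≤n⇒m<n∨m≡n k≤1+m
  ... | inj₁ (s≤s k≤m) = ∈-++⁺ˡ (∈-lambertSumList⁺ 0<k k≤m le e∈)
  ... | inj₂ refl      = ∈-++⁺ʳ (lambertSumList M m _) (∈-mulLambertList⁺ (M m) 0<k le e∈)

  lambertSumList-unique : (∀ m x → Unique (M m x)) → ∀ m i → Unique (lambertSumList M m i)
  lambertSumList-unique unique zero    i = []
  lambertSumList-unique unique (suc m) i =
    Unique.++⁺ (lambertSumList-unique unique m i) (mulLambertList-unique (suc m) i (unique m)) disjoint
    where
    disjoint : ∀ {x} → ¬ (x ∈ lambertSumList M m i × x ∈ mulLambertList (suc m) (M m) i)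
    disjoint {k , j , e} (x∈ˡ , x∈ʳ) with ∈-lambertSumList⁻ m i x∈ˡ | ∈-mulLambertList⁻ (suc m) (M m) i x∈ʳ
    ... | _ , k≤m , _ | refl , _ = <-irrefl refl k≤m

oneList : ℕ → List ⊤
oneList zero    = tt ∷ []
oneList (suc _) = []

length-oneList : ∀ x → length (oneList x) ≡ one x
length-oneList zero    = refl
length-oneList (suc _) = refl

oneList-unique : ∀ x → Unique (oneList x)
oneList-unique zero    = All.[] ∷ []
oneList-unique (suc _) = []

∈-oneList⁻ : ∀ {x} → tt ∈ oneList x → x ≡ 0
∈-oneList⁻ {zero} _ = refl

Factorisation Representation : Set
Factorisation  = ℕ × ℕ × ⊤
Representation = ℕ × ℕ × Factorisation

divisorList : ℕ → ℕ → List Factorisation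
divisorList = lambertSumList (λ _ → oneList)

pairList : ℕ → ℕ → List Representation
pairList = lambertSumList divisorList

length-divisorList : ∀ m i → length (divisorList m i) ≡ e₁ m i
length-divisorList = length-lambertSumList (λ _ → length-oneList)

length-pairList : ∀ m i → length (pairList m i) ≡ e₂ m i
length-pairList = length-lambertSumList length-divisorList

divisorList-unique : ∀ m i → Unique (divisorList m i)
divisorList-unique = lambertSumList-unique (λ _ → oneList-unique)

pairList-unique : ∀ m i → Unique (pairList m i)
pairList-unique = lambertSumList-unique divisorList-unique

∈-divisorList⁻ : ∀ m i {k j} → (k , j , tt) ∈ divisorList m i → 0 < k × k ≤ m × suc j * k ≡ i
∈-divisorList⁻ m i x∈ with ∈-lambertSumList⁻ m i x∈
... | 0<k , k≤m , le , tt∈ = 0<k , k≤m , ≤-antisym le (m∸n≡0⇒m≤n (∈-oneList⁻ tt∈))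

∈-divisorList⁺ : ∀ {m i k j} → 0 < k → k ≤ m → suc j * k ≡ i → (k , j , tt) ∈ divisorList m i
∈-divisorList⁺ {k = k} {j} 0<k k≤m refl =
  ∈-lambertSumList⁺ 0<k k≤m ≤-refl (subst (λ x → tt ∈ oneList x) (sym (n∸n≡0 (suc j * k))) (here refl))

data IsFactorisation (n : ℕ) : Factorisation → Set where
  factorisation : ∀ {k j} → suc j * suc k ≡ n → IsFactorisation n (suc k , j , tt)

data IsRepresentation (n : ℕ) : Representation → Set where
  representation : ∀ {K J l J′} → suc l < K → suc J * K + suc J′ * suc l ≡ n →
                   IsRepresentation n (K , J , suc l , J′ , tt)

divisorList-sound : ∀ n {x} → x ∈ divisorList n n → IsFactorisation n x
divisorList-sound n {_ , _ , tt} x∈ with ∈-divisorList⁻ n n x∈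
... | s≤s z≤n , _ , eq = factorisation eq

divisorList-complete : ∀ {n x} → IsFactorisation n x → x ∈ divisorList n n
divisorList-complete (factorisation {k} {j} eq) =
  ∈-divisorList⁺ (s≤s z≤n) (≤-trans (m≤n*m (suc k) (suc j)) (≤-reflexive eq)) eq

pairList-sound : ∀ n {x} → x ∈ pairList n n → IsRepresentation n x
pairList-sound n {K , J , _ , _ , tt} x∈ with ∈-lambertSumList⁻ n n x∈
... | s≤s z≤n , _ , le , y∈ with ∈-divisorList⁻ (pred K) (n ∸ suc J * K) y∈
...   | s≤s z≤n , L≤K-1 , eq = representation (s≤s L≤K-1) (trans (cong (suc J * K +_) eq) (m+[n∸m]≡n le))

pairList-complete : ∀ {n x} → IsRepresentation n x → x ∈ pairList n n
pairList-complete (representation {suc K} {J} {l} {J′} (s≤s L≤K) refl) =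
  ∈-lambertSumList⁺ (s≤s z≤n) (≤-trans (m≤n*m (suc K) (suc J)) (m≤m+n _ _)) (m≤m+n _ _)
    (∈-divisorList⁺ (s≤s z≤n) L≤K (sym (m+n∸m≡n (suc J * suc K) (suc J′ * suc l))))

-- Counting with involutions

module _ {X : Set} (_≟_ : DecidableEquality X) where

  remove : X → List X → List X
  remove y = filter (λ x → ¬? (x ≟ y))

  ∈-remove⁻ : ∀ {x y xs} → x ∈ remove y xs → x ∈ xs × x ≢ y
  ∈-remove⁻ {y = y} = ∈-filter⁻ (λ x → ¬? (x ≟ y))

  ∈-remove⁺ : ∀ {x y xs} → x ∈ xs → x ≢ y → x ∈ remove y xs
  ∈-remove⁺ {y = y} = ∈-filter⁺ (λ x → ¬? (x ≟ y))

  ↭-remove : ∀ {y xs} → Unique xs → y ∈ xs → xs ↭ y ∷ remove y xs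
  ↭-remove {y} {_ ∷ xs} (y∉xs ∷ _) (here refl) = ↭-reflexive (cong (y ∷_) (sym (begin
    remove y (y ∷ xs) ≡⟨ filter-reject (λ x → ¬? (x ≟ y)) (λ y≢y → y≢y refl) ⟩
    remove y xs       ≡⟨ filter-all (λ x → ¬? (x ≟ y)) (All.map (λ y≢x x≡y → y≢x (sym x≡y)) y∉xs) ⟩
    xs                ∎)))
  ↭-remove {y} {z ∷ xs} (z∉xs ∷ unique) (there y∈xs) = ↭-trans
    (↭-prep z (↭-remove unique y∈xs))
    (↭-trans (↭-swap z y ↭-refl)
             (↭-reflexive (cong (y ∷_) (sym (filter-accept (λ x → ¬? (x ≟ y)) (All.lookup z∉xs y∈xs))))))

  module _ (f : X → X) where

    record FreeInvolution (L : List X) : Set where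
      field
        unique         : Unique L
        closed         : ∀ {x} → x ∈ L → f x ∈ L
        involutive     : ∀ {x} → x ∈ L → f (f x) ≡ x
        fixedPointFree : ∀ {x} → x ∈ L → f x ≢ x

    module _ {x xs} (inv : FreeInvolution (x ∷ xs)) where
      open FreeInvolution inv

      private
        x∉xs : ∀ {y} → y ∈ xs → y ≢ x
        x∉xs {y} y∈xs y≡x with unique
        ... | x∉ ∷ _ = All.lookup x∉ y∈xs (sym y≡x)

        fx∈xs : f x ∈ xs
        fx∈xs with closed (here refl)
        ... | here fx≡x = ⊥-elim (fixedPointFree (here refl) fx≡x)
        ... | there fx∈ = fx∈

      ↭-removeOrbit : x ∷ xs ↭ x ∷ f x ∷ remove (f x) xs
      ↭-removeOrbit with unique
      ... | _ ∷ xs-unique = ↭-prep x (↭-remove xs-unique fx∈xs)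

      FreeInvolution-removeOrbit : FreeInvolution (remove (f x) xs)
      FreeInvolution-removeOrbit = record
        { unique         = Unique.filter⁺ (λ y → ¬? (y ≟ f x)) (tail-unique unique)
        ; closed         = closed′
        ; involutive     = involutive ∘ there ∘ inXs
        ; fixedPointFree = fixedPointFree ∘ there ∘ inXs
        }
        where
        tail-unique : Unique (x ∷ xs) → Unique xs
        tail-unique (_ ∷ u) = u
        inXs : ∀ {y} → y ∈ remove (f x) xs → y ∈ xs
        inXs y∈ = let y∈xs , _ = ∈-remove⁻ y∈ in y∈xs
        closed′ : ∀ {y} → y ∈ remove (f x) xs → f y ∈ remove (f x) xs
        closed′ {y} y∈ with ∈-remove⁻ y∈
        ... | y∈xs , y≢fx with closed (there y∈xs)
        ...   | here fy≡x = ⊥-elim (y≢fx (trans (sym (involutive (there y∈xs))) (cong f fy≡x)))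
        ...   | there fy∈xs = ∈-remove⁺ fy∈xs λ fy≡fx →
                  x∉xs y∈xs (trans (sym (involutive (there y∈xs))) (trans (cong f fy≡fx) (involutive (here refl))))

      removeOrbit-shorter : length (remove (f x) xs) < length (x ∷ xs)
      removeOrbit-shorter = s≤s (length-filter (λ y → ¬? (y ≟ f x)) xs)

    private
      _⊏_ : List X → List X → Set
      _⊏_ = _<_ on length

      ⊏-wellFounded : ∀ L → Acc _⊏_ L
      ⊏-wellFounded = wellFounded length <-wellFounded

    FreeInvolution⇒even : ∀ {L} → FreeInvolution L → ∃ λ t → length L ≡ 2 * t
    FreeInvolution⇒even = go (⊏-wellFounded _)
      where
      go : ∀ {L} → Acc _⊏_ L → FreeInvolution L → ∃ λ t → length L ≡ 2 * t
      go {[]}     _         _   = 0 , refl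
      go {x ∷ xs} (acc rec) inv =
        let t , eq = go (rec (removeOrbit-shorter inv)) (FreeInvolution-removeOrbit inv)
        in suc t , (begin
          length (x ∷ xs)                              ≡⟨ ↭-length (↭-removeOrbit inv) ⟩
          2 + length (remove (f x) xs)                 ≡⟨ cong (2 +_) eq ⟩
          2 + 2 * t                                    ≡⟨ *-suc 2 t ⟨
          2 * suc t                                    ∎)

    module _ {Q : Pred X 0ℓ} (Q? : Decidable Q) where

      length≡2*|filter| : ∀ {L} → FreeInvolution L →
                          (∀ {x} → x ∈ L → Q x → ¬ Q (f x)) → (∀ {x} → x ∈ L → ¬ Q x → Q (f x)) →
                          length L ≡ 2 * length (filter Q? L)
      length≡2*|filter| = go (⊏-wellFounded _)
        where
        go : ∀ {L} → Acc _⊏_ L → FreeInvolution L →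
             (∀ {x} → x ∈ L → Q x → ¬ Q (f x)) → (∀ {x} → x ∈ L → ¬ Q x → Q (f x)) →
             length L ≡ 2 * length (filter Q? L)
        go {[]}     _         _   _    _      = refl
        go {x ∷ xs} (acc rec) inv once always = begin
          length (x ∷ xs)                            ≡⟨ ↭-length (↭-removeOrbit inv) ⟩
          2 + length R                               ≡⟨ cong (2 +_) ih ⟩
          2 + 2 * length (filter Q? R)               ≡⟨ *-suc 2 _ ⟨
          2 * suc (length (filter Q? R))             ≡⟨ cong (2 *_) count-orbit ⟨
          2 * length (filter Q? (x ∷ f x ∷ R))
            ≡⟨ cong (2 *_) (↭-length (filter-↭ Q? (↭-removeOrbit inv))) ⟨
          2 * length (filter Q? (x ∷ xs))            ∎
          where
          R : List X
          R = remove (f x) xs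
          inL : ∀ {y} → y ∈ R → y ∈ x ∷ xs
          inL y∈ = let y∈xs , _ = ∈-remove⁻ y∈ in there y∈xs
          ih : length R ≡ 2 * length (filter Q? R)
          ih = go (rec (removeOrbit-shorter inv)) (FreeInvolution-removeOrbit inv) (once ∘ inL) (always ∘ inL)
          count-orbit : length (filter Q? (x ∷ f x ∷ R)) ≡ suc (length (filter Q? R))
          count-orbit with Q? x
          ... | yes qx with Q? (f x)
          ...   | yes qfx = ⊥-elim (once (here refl) qx qfx)
          ...   | no _    = refl
          count-orbit | no ¬qx with Q? (f x)
          ...   | yes _   = refl
          ...   | no ¬qfx = ⊥-elim (¬qfx (always (here refl) ¬qx))

module _ {A B : Set} (_≟ᴬ_ : DecidableEquality A) (_≟ᴮ_ : DecidableEquality B)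
         (φ : B → B) (to : A → B) (from : B → A) where

  private
    fixOrMove : (b : B) → Dec (φ b ≡ b) → A ⊎ B
    fixOrMove b (yes _) = inj₁ (from b)
    fixOrMove b (no _)  = inj₂ (φ b)

    ψ : A ⊎ B → A ⊎ B
    ψ (inj₁ a) = inj₂ (to a)
    ψ (inj₂ b) = fixOrMove b (φ b ≟ᴮ b)

  matchedFixedPoints⇒even :
    ∀ {S P} → Unique S → Unique P →
    (∀ {b} → b ∈ P → φ b ∈ P × φ (φ b) ≡ b) →
    (∀ {a} → a ∈ S → to a ∈ P × φ (to a) ≡ to a × from (to a) ≡ a) →
    (∀ {b} → b ∈ P → φ b ≡ b → from b ∈ S × to (from b) ≡ b) →
    ∃ λ t → length S + length P ≡ 2 * t
  matchedFixedPoints⇒even {S} {P} S-unique P-unique φ-involution to-fixed from-fixed =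
    let t , eq = FreeInvolution⇒even (Sum.≡-dec _≟ᴬ_ _≟ᴮ_) ψ ψ-free
    in t , trans (sym length-U) eq
    where
    U : List (A ⊎ B)
    U = map inj₁ S ++ map inj₂ P

    length-U : length U ≡ length S + length P
    length-U = trans (length-++ (map inj₁ S)) (cong₂ _+_ (length-map inj₁ S) (length-map inj₂ P))

    inj₁∈U⁻ : ∀ {a} → inj₁ a ∈ U → a ∈ S
    inj₁∈U⁻ a∈ with ∈-++⁻ (map inj₁ S) a∈
    ... | inj₁ a∈ˡ with ∈-map⁻ inj₁ a∈ˡ
    ...   | _ , a∈S , refl = a∈S
    inj₁∈U⁻ a∈ | inj₂ a∈ʳ with ∈-map⁻ inj₂ a∈ʳ
    ...   | _ , _ , ()

    inj₂∈U⁻ : ∀ {b} → inj₂ b ∈ U → b ∈ P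
    inj₂∈U⁻ b∈ with ∈-++⁻ (map inj₁ S) b∈
    ... | inj₁ b∈ˡ with ∈-map⁻ inj₁ b∈ˡ
    ...   | _ , _ , ()
    inj₂∈U⁻ b∈ | inj₂ b∈ʳ with ∈-map⁻ inj₂ b∈ʳ
    ...   | _ , b∈P , refl = b∈P

    inj₁∈U⁺ : ∀ {a} → a ∈ S → inj₁ a ∈ U
    inj₁∈U⁺ = ∈-++⁺ˡ ∘ ∈-map⁺ inj₁

    inj₂∈U⁺ : ∀ {b} → b ∈ P → inj₂ b ∈ U
    inj₂∈U⁺ = ∈-++⁺ʳ (map inj₁ S) ∘ ∈-map⁺ inj₂

    U-unique : Unique U
    U-unique = Unique.++⁺ (Unique.map⁺ Sum.inj₁-injective S-unique) (Unique.map⁺ Sum.inj₂-injective P-unique)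
      λ (x∈ˡ , x∈ʳ) → case (∈-map⁻ inj₁ x∈ˡ , ∈-map⁻ inj₂ x∈ʳ) of λ where
        ((_ , _ , refl) , (_ , _ , ()))

    ψ-closed : ∀ {u} → u ∈ U → ψ u ∈ U
    ψ-closed {inj₁ a} a∈ = let to-a∈P , _ = to-fixed (inj₁∈U⁻ a∈) in inj₂∈U⁺ to-a∈P
    ψ-closed {inj₂ b} b∈ with φ b ≟ᴮ b
    ... | yes fixed = let from-b∈S , _ = from-fixed (inj₂∈U⁻ b∈) fixed in inj₁∈U⁺ from-b∈S
    ... | no _      = let φb∈P , _ = φ-involution (inj₂∈U⁻ b∈) in inj₂∈U⁺ φb∈P

    ψ-involutive : ∀ {u} → u ∈ U → ψ (ψ u) ≡ u
    ψ-involutive {inj₁ a} a∈ with to-fixed (inj₁∈U⁻ a∈)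
    ... | _ , fixed , from-to with φ (to a) ≟ᴮ to a
    ...   | yes _     = cong inj₁ from-to
    ...   | no moved  = ⊥-elim (moved fixed)
    ψ-involutive {inj₂ b} b∈ with φ b ≟ᴮ b
    ... | yes fixed = let _ , to-from = from-fixed (inj₂∈U⁻ b∈) fixed in cong inj₂ to-from
    ... | no moved with φ-involution (inj₂∈U⁻ b∈)
    ...   | _ , φφb≡b with φ (φ b) ≟ᴮ φ b
    ...     | yes φb-fixed = ⊥-elim (moved (trans (sym φb-fixed) φφb≡b))
    ...     | no _         = cong inj₂ φφb≡b

    ψ-fixedPointFree : ∀ {u} → u ∈ U → ψ u ≢ u
    ψ-fixedPointFree {inj₁ a} _ ()
    ψ-fixedPointFree {inj₂ b} _ ψb≡b with φ b ≟ᴮ b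
    ψ-fixedPointFree {inj₂ b} _ () | yes _
    ψ-fixedPointFree {inj₂ b} _ ψb≡b | no moved = moved (Sum.inj₂-injective ψb≡b)

    ψ-free : FreeInvolution (Sum.≡-dec _≟ᴬ_ _≟ᴮ_) ψ U
    ψ-free = record
      { unique = U-unique ; closed = ψ-closed ; involutive = ψ-involutive ; fixedPointFree = ψ-fixedPointFree }

-- Factorisations and representations of n

odd-factor : ∀ m k {N} → m * k ≡ N → N % 2 ≡ 1 → m % 2 ≡ 1
odd-factor m k refl N-odd with m % 2 | m%n<n m 2 | %-distribˡ-* m k 2
... | 0           | _               | N%2≡0 = ⊥-elim (0≢1+n (trans (sym N%2≡0) N-odd))
... | 1           | _               | _     = refl
... | suc (suc _) | s≤s (s≤s ())    | _

odd-form : ∀ {m} → m % 2 ≡ 1 → m ≡ suc (m / 2 * 2)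
odd-form {m} m-odd = trans (m≡m%n+[m/n]*n m 2) (cong (_+ m / 2 * 2) m-odd)

odd-gap : ∀ {k c} → k % 2 ≡ 1 → c % 2 ≡ 1 → k < c → ∃ λ e → c ≡ k + 2 * suc e
odd-gap {k} {c} k-odd c-odd k<c =
  let e , eq = m≤n⇒∃[o]m+o≡n (*-cancelʳ-< 2 (k / 2) (c / 2)
                 (≤-pred (subst₂ _<_ (odd-form k-odd) (odd-form c-odd) k<c)))
  in e , (begin
    c                           ≡⟨ odd-form c-odd ⟩
    suc (c / 2 * 2)             ≡⟨ cong (λ b → suc (b * 2)) eq ⟨
    suc ((suc (k / 2) + e) * 2) ≡⟨ regroup (k / 2) e ⟩
    suc (k / 2 * 2) + 2 * suc e ≡⟨ cong (_+ 2 * suc e) (odd-form k-odd) ⟨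
    k + 2 * suc e               ∎)
  where
  regroup : ∀ a e → suc ((suc a + e) * 2) ≡ suc (a * 2) + 2 * suc e
  regroup = solve-∀

_≟ᶠ_ : DecidableEquality Factorisation
_≟ᶠ_ = Product.≡-dec _≟_ (Product.≡-dec _≟_ Unit._≟_)

_≟ʳ_ : DecidableEquality Representation
_≟ʳ_ = Product.≡-dec _≟_ (Product.≡-dec _≟_ _≟ᶠ_)

σ : Factorisation → Factorisation
σ (k , j , tt) = suc j , pred k , tt

Small : Factorisation → Set
Small (k , j , _) = k < suc j

small? : ∀ x → Dec (Small x)
small? (k , j , _) = k <? suc j

σ-factorisation : ∀ {n x} → IsFactorisation n x → IsFactorisation n (σ x)
σ-factorisation (factorisation {k} {j} eq) = factorisation (trans (*-comm (suc k) (suc j)) eq)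

σ-involutive : ∀ {n x} → IsFactorisation n x → σ (σ x) ≡ x
σ-involutive (factorisation _) = refl

σ-fixed⇒square : ∀ {n x} → IsFactorisation n x → σ x ≡ x → ∃ λ m → m * m ≡ n
σ-fixed⇒square {n} (factorisation {k} eq) σx≡x = suc k , subst (λ c → c * suc k ≡ n) (cong proj₁ σx≡x) eq

σ-small : ∀ {n x} → IsFactorisation n x → Small x → ¬ Small (σ x)
σ-small (factorisation _) = <-asym

σ-large : ∀ {n x} → IsFactorisation n x → σ x ≢ x → ¬ Small x → Small (σ x)
σ-large (factorisation {k} {j} _) σx≢x ¬small with <-cmp (suc k) (suc j)
... | tri< small _ _ = ⊥-elim (¬small small)
... | tri≈ _ refl _  = ⊥-elim (σx≢x refl)
... | tri> _ _ large = large

-- (J + 1) K + (J′ + 1) L = L (J + J′ + 2) + (K − L) (J + 1)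
φ : Representation → Representation
φ (K , J , L , J′ , tt) = suc (suc (J + J′)) , pred L , suc J , K ∸ suc L , tt

fixedPoint : ℕ → ℕ → Representation
fixedPoint J J′ = suc (suc (J + J′)) , J , suc J , J′ , tt

φ-fixedPoint : ∀ J J′ → φ (fixedPoint J J′) ≡ fixedPoint J J′
φ-fixedPoint J J′ = cong (λ x → suc (suc (J + J′)) , J , suc J , x , tt) (m+n∸m≡n J J′)

φ-fixed⇒fixedPoint : ∀ {K J L J′} → φ (K , J , L , J′ , tt) ≡ (K , J , L , J′ , tt) →
                      (K , J , L , J′ , tt) ≡ fixedPoint J J′
φ-fixed⇒fixedPoint φb≡b with cong proj₁ φb≡b | cong (proj₁ ∘ proj₂ ∘ proj₂) φb≡b
... | refl | refl = refl

φ-representation : ∀ {n b} → IsRepresentation n b → IsRepresentation n (φ b) × φ (φ b) ≡ b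
φ-representation (representation {J = J} {l} {J′} L<K eq) with m≤n⇒∃[o]m+o≡n L<K
... | d , refl rewrite m+n∸m≡n l d =
    representation (s≤s (s≤s (m≤m+n J J′))) (trans (weight J J′ l d) eq)
  , cong (λ x → suc (suc (l + d)) , J , suc l , x , tt) (m+n∸m≡n J J′)
  where
  weight : ∀ J J′ l d → suc l * suc (suc (J + J′)) + suc d * suc J ≡ suc J * suc (suc (l + d)) + suc J′ * suc l
  weight = solve-∀

factorisationOf : Representation → Factorisation
factorisationOf (K , J , L , J′ , tt) = suc J , J + 2 * suc J′ , tt

-- Inverse to factorisationOf on the fixed points of φ: for odd n a codivisor j + 1 exceeds
-- a smaller divisor k by an even number 2 (J′ + 1).
fixedPointOf : Factorisation → Representation
fixedPointOf (k , j , tt) = fixedPoint (pred k) (pred ((j ∸ pred k) / 2))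

fixedPointOf-factorisationOf : ∀ J J′ → fixedPointOf (suc J , J + 2 * suc J′ , tt) ≡ fixedPoint J J′
fixedPointOf-factorisationOf J J′ = cong (fixedPoint J ∘ pred) (begin
  (J + 2 * suc J′ ∸ J) / 2 ≡⟨ cong (_/ 2) (m+n∸m≡n J (2 * suc J′)) ⟩
  2 * suc J′ / 2           ≡⟨ cong (_/ 2) (*-comm 2 (suc J′)) ⟩
  suc J′ * 2 / 2           ≡⟨ m*n/n≡m (suc J′) 2 ⟩
  suc J′                   ∎)

fixedPoint-weight : ∀ J J′ → suc J * suc (suc (J + J′)) + suc J′ * suc J ≡ suc (J + 2 * suc J′) * suc J
fixedPoint-weight = solve-∀

fixedPoint-representation : ∀ {n} J J′ → suc (J + 2 * suc J′) * suc J ≡ n →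
                            IsRepresentation n (fixedPoint J J′) × φ (fixedPoint J J′) ≡ fixedPoint J J′ ×
                            factorisationOf (fixedPoint J J′) ≡ (suc J , J + 2 * suc J′ , tt)
fixedPoint-representation J J′ eq =
  representation (s≤s (s≤s (m≤m+n J J′))) (trans (fixedPoint-weight J J′) eq) , φ-fixedPoint J J′ , refl

fixedPointOf-small : ∀ {n a} → n % 2 ≡ 1 → IsFactorisation n a → Small a →
            IsRepresentation n (fixedPointOf a) × φ (fixedPointOf a) ≡ fixedPointOf a ×
            factorisationOf (fixedPointOf a) ≡ a
fixedPointOf-small {n} n-odd (factorisation {J} {j} eq) small
  with odd-gap (odd-factor (suc J) (suc j) (trans (*-comm (suc J) (suc j)) eq) n-odd)
               (odd-factor (suc j) (suc J) eq n-odd) small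
... | e , gap with suc-injective gap
...   | refl = subst (λ b → IsRepresentation n b × φ b ≡ b × factorisationOf b ≡ (suc J , j , tt))
                     (sym (fixedPointOf-factorisationOf J e)) (fixedPoint-representation J e eq)

factorisationOf-fixed : ∀ {n b} → IsRepresentation n b → φ b ≡ b →
            IsFactorisation n (factorisationOf b) × Small (factorisationOf b) × fixedPointOf (factorisationOf b) ≡ b
factorisationOf-fixed (representation {J = J} {J′ = J′} _ eq) φb≡b with φ-fixed⇒fixedPoint φb≡b
... | refl = factorisation (trans (sym (fixedPoint-weight J J′)) eq) , s≤s (m<m+n J (s≤s z≤n))
           , fixedPointOf-factorisationOf J J′

module _ (n : ℕ) where

  smallDivisors : List Factorisation
  smallDivisors = filter small? (divisorList n n)

  σ-free : ¬ (∃ λ m → m * m ≡ n) → FreeInvolution _≟ᶠ_ σ (divisorList n n)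
  σ-free nonSquare = record
    { unique         = divisorList-unique n n
    ; closed         = divisorList-complete ∘ σ-factorisation ∘ divisorList-sound n
    ; involutive     = σ-involutive ∘ divisorList-sound n
    ; fixedPointFree = λ x∈ → nonSquare ∘ σ-fixed⇒square (divisorList-sound n x∈)
    }

  e₁≡2*smallDivisors : ¬ (∃ λ m → m * m ≡ n) → e₁ n n ≡ 2 * length smallDivisors
  e₁≡2*smallDivisors nonSquare = trans (sym (length-divisorList n n))
    (length≡2*|filter| _≟ᶠ_ σ small? (σ-free nonSquare)
      (σ-small ∘ divisorList-sound n)
      (λ x∈ → σ-large (divisorList-sound n x∈) (FreeInvolution.fixedPointFree (σ-free nonSquare) x∈)))

  smallDivisors+e₂-even : n % 2 ≡ 1 → ∃ λ t → length smallDivisors + e₂ n n ≡ 2 * t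
  smallDivisors+e₂-even n-odd =
    let t , eq = matchedFixedPoints⇒even _≟ᶠ_ _≟ʳ_ φ fixedPointOf factorisationOf
                   (Unique.filter⁺ small? (divisorList-unique n n)) (pairList-unique n n)
                   φ-pairList fixedPointOf-matches factorisationOf-matches
    in t , trans (cong (length smallDivisors +_) (sym (length-pairList n n))) eq
    where
    φ-pairList : ∀ {b} → b ∈ pairList n n → φ b ∈ pairList n n × φ (φ b) ≡ b
    φ-pairList b∈ = let rep , φφb≡b = φ-representation (pairList-sound n b∈) in pairList-complete rep , φφb≡b
    fixedPointOf-matches : ∀ {a} → a ∈ smallDivisors →
                           fixedPointOf a ∈ pairList n n × φ (fixedPointOf a) ≡ fixedPointOf a ×
                           factorisationOf (fixedPointOf a) ≡ a
    fixedPointOf-matches a∈ with ∈-filter⁻ small? a∈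
    ... | a∈divisors , small with fixedPointOf-small n-odd (divisorList-sound n a∈divisors) small
    ...   | rep , fixed , inverse = pairList-complete rep , fixed , inverse
    factorisationOf-matches : ∀ {b} → b ∈ pairList n n → φ b ≡ b →
                              factorisationOf b ∈ smallDivisors × fixedPointOf (factorisationOf b) ≡ b
    factorisationOf-matches b∈ fixed with factorisationOf-fixed (pairList-sound n b∈) fixed
    ... | fac , small , inverse = ∈-filter⁺ small? (divisorList-complete fac) small , inverse

2[2s+2[e+2c]]≡[t+c]*8 : ∀ s e c t → s + e ≡ 2 * t → 2 * (2 * s + 2 * (e + 2 * c)) ≡ (t + c) * 8
2[2s+2[e+2c]]≡[t+c]*8 s e c t eq = begin
  2 * (2 * s + 2 * (e + 2 * c)) ≡⟨ regroup s e c ⟩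
  4 * (s + e) + 8 * c           ≡⟨ cong (λ x → 4 * x + 8 * c) eq ⟩
  4 * (2 * t) + 8 * c           ≡⟨ regroup′ t c ⟩
  (t + c) * 8                   ∎
  where
  regroup : ∀ s e c → 2 * (2 * s + 2 * (e + 2 * c)) ≡ 4 * (s + e) + 8 * c
  regroup = solve-∀
  regroup′ : ∀ t c → 4 * (2 * t) + 8 * c ≡ (t + c) * 8
  regroup′ = solve-∀

theorem1p9 : (n : ℕ) → n % 2 ≡ 1 → ¬ (∃ λ m → m * m ≡ n) → 8 ∣ overpartition n
theorem1p9 zero      ()
theorem1p9 n@(suc _) n-odd nonSquare =
  let t , s+e₂≡2t = smallDivisors+e₂-even n n-odd in
  divides (t + C) (begin
    overpartition n                              ≡⟨ overGF-expansion n n ⟩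
    0 + 2 * (e₁ n n + 2 * (e₂ n n + 2 * C))      ≡⟨ cong (λ x → 2 * (x + 2 * (e₂ n n + 2 * C)))
                                                         (e₁≡2*smallDivisors n nonSquare) ⟩
    2 * (2 * s + 2 * (e₂ n n + 2 * C))           ≡⟨ 2[2s+2[e+2c]]≡[t+c]*8 s (e₂ n n) C t s+e₂≡2t ⟩
    (t + C) * 8                                  ∎)
  where
  s = length (smallDivisors n)
  C = higher n n
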